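{- Let $n\ge 1$ and let $\mathcal{S}\subseteq\mathcal{P}([n])$ satisfy Reimer's conditions via a filter $\mathcal{F}\subseteq\mathcal{P}([n])$ and bijection $A\mapsto F_A$, where $\mathcal{F}$ contains every subset of $[n]$ of size at least $n-1$. Then the set $A\in\mathcal{S}$ with $F_A=[n]$ is $A=[n]$.
   Context: $[n]=\{1,\ldots,n\}$. For $A\subseteq B\subseteq[n]$, $[A,B]=\{C: A\subseteq C\subseteq B\}$. A family $\mathcal{F}\subseteq\mathcal{P}([n])$ is a filter if $F\in\mathcal{F}$ and $i\in[n]$ imply $F\cup\{i\}\in\mathcal{F}$. A family $\mathcal{S}\subseteq\mathcal{P}([n])$ satisfies Reimer's conditions via a filter $\mathcal{F}$ and a bijection $A\mapsto F_A$ from $\mathcal{S}$ to $\mathcal{F}$ if (1) $A\subseteq F_A$ for all $A\in\mathcal{S}$, and (2) for distinct $A,B\in\mathcal{S}$, $[A,F_A]\cap[B,F_B]=\emptyset$. -}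

module Defs where

open import Data.Nat using (ℕ; _∸_; _≤_)
open import Data.Fin using (Fin)
open import Data.Fin.Subset using (Subset; _⊆_; _∪_; ⁅_⁆; ∣_∣)
open import Data.Product using (Σ; _×_; ∃)
open import Relation.Nullary using (¬_)
open import Relation.Binary.PropositionalEquality using (_≡_)

Family : ℕ → Set₁
Family n = Subset n → Set

IsFilter : ∀ {n} → Family n → Set
IsFilter {n} 𝓕 = ∀ (X : Subset n) (i : Fin n) → 𝓕 X → 𝓕 (X ∪ ⁅ i ⁆)

InInterval : ∀ {n} → Subset n → Subset n → Subset n → Set
InInterval A B C = A ⊆ C × C ⊆ B

record Reimer {n : ℕ} (𝓢 𝓕 : Family n) (F : Subset n → Subset n) : Set where
  field
    filter      : IsFilter 𝓕
    maps-into   : ∀ A → 𝓢 A → 𝓕 (F A)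
    injective   : ∀ A B → 𝓢 A → 𝓢 B → F A ≡ F B → A ≡ B
    surjective  : ∀ X → 𝓕 X → Σ (Subset n) (λ A → 𝓢 A × F A ≡ X)
    cond1       : ∀ A → 𝓢 A → A ⊆ F A
    cond2       : ∀ A B → 𝓢 A → 𝓢 B → ¬ (A ≡ B) →
                  ∀ C → ¬ (InInterval A (F A) C × InInterval B (F B) C)

{-# OPTIONS --safe #-}
module Submission where

open import Defs
open import Data.Bool.Properties using () renaming (_≟_ to _≟ᵇ_)
open import Data.Nat using (ℕ; _∸_; _≤_)
open import Data.Nat.Properties using (≤-reflexive)
open import Data.Fin using (Fin)
open import Data.Fin.Subset using (Subset; ⊤; ∣_∣; ∁; ⁅_⁆; _∈_; _∉_; _⊆_)
open import Data.Fin.Subset.Properties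
  using (_∈?_; ∈⊤; ⊆⊤; ⊆-refl; ⊆-antisym; x∈⁅x⁆; x∈⁅y⁆⇒x≡y; x∉p⇒x∈∁p; x∈∁p⇒x∉p; ∣∁p∣≡n∸∣p∣; ∣⁅x⁆∣≡1)
open import Data.Product using (_,_)
open import Data.Vec.Properties using (≡-dec)
open import Relation.Binary.PropositionalEquality using (_≡_; refl; sym; trans; cong; subst)
open import Relation.Nullary.Decidable using (decidable-stable)

-- If i ∉ A, the co-singleton [n] ∖ {i} is in 𝓕, hence equals F_B for some B ∈ 𝓢.
-- It also lies in [A, F_A] = [A, [n]], so the intervals of A and B meet, which
-- by Reimer's condition (2) forces A = B and thus [n] = F_A = F_B = [n] ∖ {i}.

∣∁⁅x⁆∣≡n∸1 : ∀ {n} (x : Fin n) → ∣ ∁ ⁅ x ⁆ ∣ ≡ n ∸ 1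
∣∁⁅x⁆∣≡n∸1 {n} x = trans (∣∁p∣≡n∸∣p∣ ⁅ x ⁆) (cong (n ∸_) (∣⁅x⁆∣≡1 x))

x∉p⇒p⊆∁⁅x⁆ : ∀ {n} {x : Fin n} {p : Subset n} → x ∉ p → p ⊆ ∁ ⁅ x ⁆
x∉p⇒p⊆∁⁅x⁆ {x = x} x∉p y∈p =
  x∉p⇒x∈∁p (λ y∈⁅x⁆ → x∉p (subst (_∈ _) (x∈⁅y⁆⇒x≡y x y∈⁅x⁆) y∈p))

module _ {n} {𝓢 𝓕 : Family n} {F : Subset n → Subset n} (R : Reimer 𝓢 𝓕 F) where
  open Reimer R

  ≡-of-meeting-intervals : ∀ {A B C} → 𝓢 A → 𝓢 B →
    InInterval A (F A) C → InInterval B (F B) C → A ≡ B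
  ≡-of-meeting-intervals {A} {B} {C} sA sB C∈[A] C∈[B] =
    decidable-stable (≡-dec _≟ᵇ_ A B) (λ A≢B → cond2 A B sA sB A≢B C (C∈[A] , C∈[B]))

  filter-member-is-top-of-its-interval : ∀ {A X} → 𝓕 X → 𝓢 A →
    InInterval A (F A) X → F A ≡ X
  filter-member-is-top-of-its-interval {X = X} 𝓕X sA X∈[A] with surjective X 𝓕X
  ... | B , sB , refl = cong F (≡-of-meeting-intervals sA sB X∈[A] (cond1 B sB , ⊆-refl))

mainTheorem4 : (n : ℕ) → 1 ≤ n →
    (𝓢 𝓕 : Family n) (F : Subset n → Subset n) →
    Reimer 𝓢 𝓕 F →
    (∀ (X : Subset n) → n ∸ 1 ≤ ∣ X ∣ → 𝓕 X) →
    ∀ (A : Subset n) → 𝓢 A → F A ≡ ⊤ → A ≡ ⊤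
mainTheorem4 n _ 𝓢 𝓕 F R large A sA FA≡⊤ = ⊆-antisym ⊆⊤ ⊤⊆A
  where
  ⊤⊆A : ⊤ ⊆ A
  ⊤⊆A {i} _ = decidable-stable (i ∈? A) λ i∉A →
    let FA≡∁⁅i⁆ : F A ≡ ∁ ⁅ i ⁆
        FA≡∁⁅i⁆ = filter-member-is-top-of-its-interval R
          (large (∁ ⁅ i ⁆) (≤-reflexive (sym (∣∁⁅x⁆∣≡n∸1 i))))
          sA
          (x∉p⇒p⊆∁⁅x⁆ i∉A , subst (∁ ⁅ i ⁆ ⊆_) (sym FA≡⊤) ⊆⊤)
    in x∈∁p⇒x∉p (subst (i ∈_) (trans (sym FA≡⊤) FA≡∁⁅i⁆) ∈⊤) (x∈⁅x⁆ i)
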